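{- Let $S$ be a star graph, let $I$ be a subset of the leaves of $S$, let $v$ be a non-leaf node of $S^I$, and let $\mathcal{G}$ be a DAG with skeleton $S$. For every edge $u-v$ of $S$, $\mathbb{1}_{v\leftarrow u}(c_{\mathcal{G}^I})=1$ if the edge $u\to v$ is present in $\mathcal{G}^I$ and is part of a v-structure of $\mathcal{G}^I$, and $\mathbb{1}_{v\leftarrow u}(c_{\mathcal{G}^I})=0$ otherwise.
   Context: A star graph is a tree on at least $3$ nodes with one center node and all other nodes leaves. $\mathcal{G}^I$ is obtained from $\mathcal{G}$ by adding a new node $w'$ and an edge $w'\to w$ for each $w\in I$; $S^I$ is $S$ with these edges added. A v-structure is an induced subgraph $a\to b\leftarrow d$ (with $a,d$ non-adjacent). For a DAG $\mathcal{D}$ on a finite set $V$ and $A\subseteq V$, $c_{\mathcal{D}}(A)=1$ if some $a\in A$ has every $b\in A\setminus\{a\}$ as a parent in $\mathcal{D}$, and $0$ otherwise. For an edge $u-v$ of $S$, define the linear functional $\mathbb{1}_{v\leftarrow u}(x)=\sum_{A\subseteq V(S)\setminus\{u,v\},\ |A|\ge1}(-1)^{|A|+1}x_{A\cup\{u,v\}}$ if $v\notin I$, and $\mathbb{1}_{v\leftarrow u}(x)=x_{uvv'}$ if $v\in I$. -}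

module Defs where

open import Data.Bool using (Bool; true; false; T; _∧_; _∨_; not; if_then_else_)
open import Data.Unit using (tt)
open import Data.Empty using (⊥)
open import Data.Nat using (ℕ; zero; suc; _≤_)
open import Data.Fin using (Fin; zero; suc)
open import Data.Fin.Properties using () renaming (_≟_ to _≟F_)
open import Data.Fin.Subset using (Subset; _∪_; ⁅_⁆; ∣_∣)
open import Data.Vec using (Vec; []; _∷_; lookup)
open import Data.List using (List; []; _∷_; map; filterᵇ; allFin; foldr; _++_)
open import Data.Bool.ListAction using (any; all)
open import Data.Integer using (ℤ; +_; _*_; -_; _+_)
open import Data.Product using (Σ; _×_; _,_)
open import Data.Sum using (_⊎_; inj₁; inj₂)
open import Relation.Nullary using (¬_; Dec; yes; no; does)
open import Relation.Binary.PropositionalEquality using (_≡_; _≢_; refl)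

-- Graphs on a vertex type N.
-- Undirected graphs: Bool-valued adjacency; directed graphs: Bool-valued
-- arrow relation  D a b = true  iff  a → b.

IsLeaf : {N : Set} → (N → N → Set) → N → Set
IsLeaf {N} adj w = Σ N λ u → adj w u × (∀ y → adj w y → y ≡ u)

IsStar : (m : ℕ) → (Fin m → Fin m → Bool) → Set
IsStar m S = (3 ≤ m) × Σ (Fin m) λ c → ∀ x y →
  (T (S x y) → (x ≡ c × y ≢ c) ⊎ (y ≡ c × x ≢ c)) ×
  ((x ≡ c × y ≢ c) ⊎ (y ≡ c × x ≢ c) → T (S x y))

data Path {N : Set} (D : N → N → Bool) : N → N → Set where
  edge : ∀ {a b} → T (D a b) → Path D a b
  step : ∀ {a b c} → T (D a b) → Path D b c → Path D a c

IsDAG : {N : Set} → (N → N → Bool) → Set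
IsDAG {N} D = ∀ x → ¬ Path D x x

HasSkeleton : {N : Set} → (N → N → Bool) → (N → N → Bool) → Set
HasSkeleton {N} D S = ∀ x y →
  (T (S x y) → T (D x y) ⊎ T (D y x)) ×
  (T (D x y) → T (S x y)) ×
  ¬ (T (D x y) × T (D y x))

-- Intervened graphs.  Nodes of 𝒢^I / S^I: the original nodes  inj₁ w
-- and a new node  inj₂ (w , _)  (written w') for each w ∈ I.

Node : (m : ℕ) → (Fin m → Bool) → Set
Node m I = Fin m ⊎ Σ (Fin m) (λ w → T (I w))

T-irr : (b : Bool) (p q : T b) → p ≡ q
T-irr true tt tt = refl

_≟N_ : {m : ℕ} {I : Fin m → Bool} → (x y : Node m I) → Dec (x ≡ y)
inj₁ a ≟N inj₁ b with a ≟F b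
... | yes refl = yes refl
... | no a≢b = no λ { refl → a≢b refl }
inj₁ a ≟N inj₂ _ = no λ ()
inj₂ _ ≟N inj₁ _ = no λ ()
_≟N_ {I = I} (inj₂ (a , p)) (inj₂ (b , q)) with a ≟F b
... | no a≢b = no λ { refl → a≢b refl }
... | yes refl with T-irr (I a) p q
... | refl = yes refl

skelI : {m : ℕ} (S : Fin m → Fin m → Bool) (I : Fin m → Bool) → Node m I → Node m I → Set
skelI S I (inj₁ a) (inj₁ b) = T (S a b)
skelI S I (inj₁ a) (inj₂ (w , _)) = w ≡ a
skelI S I (inj₂ (w , _)) (inj₁ b) = w ≡ b
skelI S I (inj₂ _) (inj₂ _) = ⊥

arrI : {m : ℕ} (G : Fin m → Fin m → Bool) (I : Fin m → Bool) → Node m I → Node m I → Bool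
arrI G I (inj₁ a) (inj₁ b) = G a b
arrI G I (inj₁ a) (inj₂ _) = false
arrI G I (inj₂ (w , _)) (inj₁ b) = does (w ≟F b)
arrI G I (inj₂ _) (inj₂ _) = false

adjD : {N : Set} → (N → N → Bool) → N → N → Bool
adjD D x y = D x y ∨ D y x

InVStructure : {N : Set} → (N → N → Bool) → N → N → Set
InVStructure {N} D u v = T (D u v) × Σ N λ d →
  T (D d v) × d ≢ u × ¬ T (adjD D u d)

cD : {N : Set} → ((x y : N) → Dec (x ≡ y)) → (N → N → Bool) → List N → ℤ
cD eq D A =
  if any (λ a → all (λ b → does (eq b a) ∨ D b a) A) A then + 1 else + 0

allSubsets : (m : ℕ) → List (Subset m)
allSubsets zero = [] ∷ []
allSubsets (suc m) = map (true ∷_) (allSubsets m) ++ map (false ∷_) (allSubsets m)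

elems : {m : ℕ} → Subset m → List (Fin m)
elems {m} A = filterᵇ (λ i → lookup A i) (allFin m)

sumℤ : List ℤ → ℤ
sumℤ = foldr _+_ (+ 0)

signℤ : ℕ → ℤ
signℤ zero = + 1
signℤ (suc k) = - signℤ k

caseT : (b : Bool) → (T b → ℤ) → ℤ → ℤ
caseT true f z = f tt
caseT false f z = z

-- The functional 𝟙_{v←u} applied to x (x indexed by finite sets of nodes
-- of 𝒢^I, given as lists of elements):
--   if v ∉ I : Σ_{A ⊆ V(S)∖{u,v}, |A| ≥ 1} (-1)^{|A|+1} x_{A ∪ {u,v}}
--   if v ∈ I : x_{u v v'}
indicator : {m : ℕ} (I : Fin m → Bool) (u v : Fin m) → (List (Node m I) → ℤ) → ℤ
indicator {m} I u v x =
  caseT (I v)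
    (λ p → x (inj₁ u ∷ inj₁ v ∷ inj₂ (v , p) ∷ []))
    (sumℤ (map (λ A → signℤ (suc ∣ A ∣) * x (map inj₁ (elems (A ∪ (⁅ u ⁆ ∪ ⁅ v ⁆)))))
               (filterᵇ (λ A → not (lookup A u) ∧ not (lookup A v) ∧ not (∣ A ∣ Data.Nat.≡ᵇ 0))
                        (allSubsets m))))

{-# OPTIONS --safe #-}
-- A non-leaf v of S^I is either the center of the star (and then v ∉ I, since I consists of
-- leaves) or an intervened leaf v ∈ I with its new parent v'.
--
-- If v ∈ I the functional is the single value c({u, v, v'}), which is 1 exactly when u → v;
-- and then u → v ← v' is a v-structure, as u and v' are non-adjacent.
--
-- If v is the center then, for nonempty A ⊆ V(S) ∖ {u, v}, only v can have all other
-- nodes of A ∪ {u, v} as parents (leaves are pairwise non-adjacent), so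
-- c(A ∪ {u, v}) = [u → v] [A ⊆ R], where R is the set of parents of v other than u.
-- Inclusion–exclusion, Σ_{∅ ≠ A ⊆ R} (-1)^{|A|+1} = [R ≠ ∅], turns the functional into
-- [u → v] [R ≠ ∅], and a d ∈ R is exactly the other end of a v-structure u → v ← d.
module Submission where

open import Defs
open import Data.Bool using (Bool; true; false; T; _∧_; _∨_; not; if_then_else_)
open import Data.Bool.Properties using (T-≡; T-∧; T-∨)
open import Data.Empty using (⊥-elim)
open import Data.Fin using (Fin; zero; suc; punchIn; punchOut)
open import Data.Fin.Properties using (punchInᵢ≢i; punchIn-injective; punchIn-punchOut)
  renaming (_≟_ to _≟F_)
open import Data.Fin.Subset
  using (Subset; inside; outside; _∈_; _∉_; _⊆_; _∪_; ⁅_⁆; ∣_∣; ⊥; Nonempty)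
open import Data.Fin.Subset.Properties
  using (_⊆?_; ∉⊥; in⊆in; out⊆; drop-there; x∈p∪q⁺; x∈p∪q⁻; x∈⁅x⁆; x∈⁅y⁆⇒x≡y)
open import Data.Integer using (ℤ; +_; _*_; -_; _+_)
open import Data.Integer.Properties
  using ( +-assoc; +-identityˡ; +-identityʳ; +-inverseˡ; neg-distrib-+; neg-distribˡ-*; *-zeroʳ
        ; +-commutativeSemigroup)
open import Algebra.Properties.CommutativeSemigroup +-commutativeSemigroup using (interchange)
open import Data.List using (List; []; _∷_; map; filterᵇ; allFin; _++_)
open import Data.List.Properties using (map-++; map-∘; map-cong; map-cong-local)
open import Data.List.Membership.Propositional using (find; lose) renaming (_∈_ to _∈ₗ_)
open import Data.List.Membership.Propositional.Properties
  using (∈-map⁺; ∈-map⁻; ∈-filter⁺; ∈-filter⁻; ∈-allFin)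
open import Data.List.Relation.Unary.Any using (here; there)
import Data.List.Relation.Unary.All as All
open import Data.List.Relation.Unary.All.Properties using (all⁺; all⁻)
open import Data.List.Relation.Unary.Any.Properties using (any⁺; any⁻)
open import Data.Nat using (ℕ; zero; suc; _≤_; s≤s; _≡ᵇ_)
open import Data.Nat.Properties using (≡ᵇ⇒≡)
open import Data.Product using (_×_; _,_; proj₁; proj₂; ∃)
open import Data.Sum using (_⊎_; inj₁; inj₂; [_,_]′)
import Data.Sum as Sum
open import Data.Sum.Properties using (inj₁-injective)
open import Data.Vec using ([]; _∷_; here; there; lookup; tabulate)
import Data.Vec as Vec
open import Data.Vec.Properties using ([]=⇒lookup; lookup⇒[]=; lookup∘tabulate)
open import Function using (_∘_; _⇔_; mk⇔; Equivalence)
open import Relation.Binary.PropositionalEquality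
  using (_≡_; _≢_; refl; sym; trans; cong; cong₂; subst; module ≡-Reasoning)
open import Relation.Nullary using (¬_; Dec; yes; no; does; contradiction)
open import Relation.Nullary.Decidable using (T?; ¬?; _×-dec_; decidable-stable)

open ≡-Reasoning
open Equivalence using (to; from)

T-does⁺ : ∀ {P : Set} (p? : Dec P) → P → T (does p?)
T-does⁺ (yes _) _ = _
T-does⁺ (no ¬p) p = ¬p p

T-does⁻ : ∀ {P : Set} (p? : Dec P) → T (does p?) → P
T-does⁻ (yes p) _ = p

iverson : Bool → ℤ
iverson b = if b then + 1 else + 0

iverson-T : ∀ {b} → T b → iverson b ≡ + 1
iverson-T {true} _ = refl

iverson-¬T : ∀ {b} → ¬ T b → iverson b ≡ + 0
iverson-¬T {true} ¬b = contradiction _ ¬b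
iverson-¬T {false} _ = refl

iverson-not : ∀ b → - iverson b + + 1 ≡ iverson (not b)
iverson-not true = refl
iverson-not false = refl

iverson-cases : ∀ {P : Set} {x : ℤ} b → x ≡ iverson b → P ⇔ T b →
                (P → x ≡ + 1) × (¬ P → x ≡ + 0)
iverson-cases true x≡1 P⇔b = (λ _ → x≡1) , λ ¬p → contradiction (from P⇔b _) ¬p
iverson-cases false x≡0 P⇔b = (λ p → ⊥-elim (to P⇔b p)) , λ _ → x≡0

≡iverson : ∀ {x : ℤ} b → (T b → x ≡ + 1) → (¬ T b → x ≡ + 0) → x ≡ iverson b
≡iverson true x≡1 _ = x≡1 _
≡iverson false _ x≡0 = x≡0 λ ()

caseT-true : ∀ {b} (p : T b) f z → caseT b f z ≡ f p
caseT-true {true} _ _ _ = refl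

caseT-false : ∀ {b} → ¬ T b → ∀ f z → caseT b f z ≡ z
caseT-false {true} ¬b = contradiction _ ¬b
caseT-false {false} _ _ _ = refl

sumℤ-++ : (xs ys : List ℤ) → sumℤ (xs ++ ys) ≡ sumℤ xs + sumℤ ys
sumℤ-++ [] ys = sym (+-identityˡ _)
sumℤ-++ (x ∷ xs) ys = trans (cong (_+_ x) (sumℤ-++ xs ys)) (sym (+-assoc x _ _))

module _ {X : Set} (f : X → ℤ) where

  sumℤ-map-cong : ∀ {g : X → ℤ} → (∀ x → f x ≡ g x) → ∀ xs → sumℤ (map f xs) ≡ sumℤ (map g xs)
  sumℤ-map-cong f≗g xs = cong sumℤ (map-cong f≗g xs)

  sumℤ-map-zero : (∀ x → f x ≡ + 0) → ∀ xs → sumℤ (map f xs) ≡ + 0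
  sumℤ-map-zero f≗0 [] = refl
  sumℤ-map-zero f≗0 (x ∷ xs) = cong₂ _+_ (f≗0 x) (sumℤ-map-zero f≗0 xs)

  sumℤ-map-neg : ∀ xs → sumℤ (map (λ x → - f x) xs) ≡ - sumℤ (map f xs)
  sumℤ-map-neg [] = refl
  sumℤ-map-neg (x ∷ xs) =
    trans (cong (_+_ (- f x)) (sumℤ-map-neg xs)) (sym (neg-distrib-+ (f x) _))

  sumℤ-map-+ : (g : X → ℤ) → ∀ xs →
               sumℤ (map (λ x → f x + g x) xs) ≡ sumℤ (map f xs) + sumℤ (map g xs)
  sumℤ-map-+ g [] = refl
  sumℤ-map-+ g (x ∷ xs) =
    trans (cong (_+_ (f x + g x)) (sumℤ-map-+ g xs)) (interchange (f x) (g x) _ _)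

  sumℤ-filterᵇ : (p : X → Bool) → ∀ xs →
                 sumℤ (map f (filterᵇ p xs)) ≡ sumℤ (map (λ x → if p x then f x else + 0) xs)
  sumℤ-filterᵇ p [] = refl
  sumℤ-filterᵇ p (x ∷ xs) with p x
  ... | true = cong (_+_ (f x)) (sumℤ-filterᵇ p xs)
  ... | false = trans (sumℤ-filterᵇ p xs) (sym (+-identityˡ _))

  sumℤ-filterᵇ-cong : ∀ {g : X → ℤ} (p : X → Bool) → (∀ {x} → T (p x) → f x ≡ g x) → ∀ xs →
                      sumℤ (map f (filterᵇ p xs)) ≡ sumℤ (map g (filterᵇ p xs))
  sumℤ-filterᵇ-cong p f≡g xs =
    cong sumℤ (map-cong-local (All.tabulate λ x∈ → f≡g (proj₂ (∈-filter⁻ (T? ∘ p) {xs = xs} x∈))))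

third-element : ∀ {m} → 3 ≤ m → {a b : Fin m} → a ≢ b → ∃ λ x → x ≢ a × x ≢ b
third-element (s≤s (s≤s (s≤s _))) {a} {b} a≢b =
  punchIn a (punchIn b′ zero) , punchInᵢ≢i a _ ,
  λ eq → punchInᵢ≢i b′ zero
           (punchIn-injective a _ _ (trans eq (sym (punchIn-punchOut a≢b))))
  where b′ = punchOut a≢b

module _ {n : ℕ} {p : Subset n} {x : Fin n} where

  ∈⇒T-lookup : x ∈ p → T (lookup p x)
  ∈⇒T-lookup x∈p = from T-≡ ([]=⇒lookup x∈p)

  T-lookup⇒∈ : T (lookup p x) → x ∈ p
  T-lookup⇒∈ t = lookup⇒[]= x p (to T-≡ t)

  T-not-lookup⇒∉ : T (not (lookup p x)) → x ∉ p
  T-not-lookup⇒∉ t x∈p = subst (T ∘ not) ([]=⇒lookup x∈p) t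

  ∉⇒lookup≡outside : x ∉ p → lookup p x ≡ outside
  ∉⇒lookup≡outside x∉p with lookup p x in eq
  ... | outside = refl
  ... | inside = contradiction (lookup⇒[]= x p eq) x∉p

  ∈-elems⁺ : x ∈ p → x ∈ₗ elems p
  ∈-elems⁺ x∈p = ∈-filter⁺ (T? ∘ lookup p) (∈-allFin x) (∈⇒T-lookup x∈p)

  ∈-elems⁻ : x ∈ₗ elems p → x ∈ p
  ∈-elems⁻ x∈ = T-lookup⇒∈ (proj₂ (∈-filter⁻ (T? ∘ lookup p) {xs = allFin n} x∈))

∣p∣≡0⇒¬Nonempty : ∀ {n} {p : Subset n} → ∣ p ∣ ≡ 0 → ¬ Nonempty p
∣p∣≡0⇒¬Nonempty {p = inside ∷ p} ()
∣p∣≡0⇒¬Nonempty {p = outside ∷ p} ∣p∣≡0 (suc x , there x∈p) = ∣p∣≡0⇒¬Nonempty ∣p∣≡0 (x , x∈p)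

∣p∣≢0⇒Nonempty : ∀ {n} {p : Subset n} → ∣ p ∣ ≢ 0 → Nonempty p
∣p∣≢0⇒Nonempty {p = []} ∣p∣≢0 = contradiction refl ∣p∣≢0
∣p∣≢0⇒Nonempty {p = inside ∷ p} _ = zero , here
∣p∣≢0⇒Nonempty {p = outside ∷ p} ∣p∣≢0 =
  let x , x∈p = ∣p∣≢0⇒Nonempty ∣p∣≢0 in suc x , there x∈p

∈-∉-≢ : ∀ {n} {p : Subset n} {x y} → x ∈ p → y ∉ p → x ≢ y
∈-∉-≢ {p = p} x∈p y∉p x≡y = y∉p (subst (_∈ p) x≡y x∈p)

⊈-witness : ∀ {n} {p q : Subset n} → ¬ p ⊆ q → ∃ λ x → x ∈ p × x ∉ q
⊈-witness {p = []} {[]} p⊈q = contradiction (λ ()) p⊈q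
⊈-witness {p = inside ∷ p} {outside ∷ q} _ = zero , here , λ ()
⊈-witness {p = inside ∷ p} {inside ∷ q} p⊈q =
  let x , x∈p , x∉q = ⊈-witness (p⊈q ∘ in⊆in) in suc x , there x∈p , x∉q ∘ drop-there
⊈-witness {p = outside ∷ p} {s ∷ q} p⊈q =
  let x , x∈p , x∉q = ⊈-witness (p⊈q ∘ out⊆) in suc x , there x∈p , x∉q ∘ drop-there

sumℤ-allSubsets-suc : ∀ {m} (f : Subset (suc m) → ℤ) →
  sumℤ (map f (allSubsets (suc m)))
    ≡ sumℤ (map (f ∘ (inside ∷_)) (allSubsets m)) + sumℤ (map (f ∘ (outside ∷_)) (allSubsets m))
sumℤ-allSubsets-suc {m} f = begin
  sumℤ (map f (allSubsets (suc m)))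
    ≡⟨ cong sumℤ (map-++ f (map (inside Vec.∷_) Ss) _) ⟩
  sumℤ (map f (map (inside Vec.∷_) Ss) ++ map f (map (outside Vec.∷_) Ss))
    ≡⟨ sumℤ-++ (map f (map (inside Vec.∷_) Ss)) _ ⟩
  sumℤ (map f (map (inside Vec.∷_) Ss)) + sumℤ (map f (map (outside Vec.∷_) Ss))
    ≡⟨ sym (cong₂ _+_ (cong sumℤ (map-∘ Ss)) (cong sumℤ (map-∘ Ss))) ⟩
  sumℤ (map (f ∘ (inside ∷_)) Ss) + sumℤ (map (f ∘ (outside ∷_)) Ss) ∎
  where Ss = allSubsets m

alternating-sum-⊆ : ∀ {m} (R : Subset m) →
  sumℤ (map (λ A → signℤ ∣ A ∣ * iverson (does (A ⊆? R))) (allSubsets m))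
    ≡ iverson (does (R ⊆? ⊥))
alternating-sum-⊆ [] = refl
alternating-sum-⊆ {suc m} (r ∷ R) = begin
  sumℤ (map (g (r ∷ R)) (allSubsets (suc m)))
    ≡⟨ sumℤ-allSubsets-suc (g (r ∷ R)) ⟩
  sumℤ (map (g (r ∷ R) ∘ (inside Vec.∷_)) Ss) + sumℤ (map (g R) Ss)
    ≡⟨ cong₂ _+_ (inside-half r) (alternating-sum-⊆ R) ⟩
  (if r then - iverson (does (R ⊆? ⊥)) else + 0) + iverson (does (R ⊆? ⊥))
    ≡⟨ cancel r ⟩
  iverson (does (r ∷ R ⊆? ⊥)) ∎
  where
  Ss = allSubsets m
  g : ∀ {n} → Subset n → Subset n → ℤ
  g R A = signℤ ∣ A ∣ * iverson (does (A ⊆? R))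

  inside-half : ∀ r → sumℤ (map (g (r ∷ R) ∘ (inside Vec.∷_)) Ss)
                       ≡ (if r then - iverson (does (R ⊆? ⊥)) else + 0)
  inside-half outside = sumℤ-map-zero _ (λ A → *-zeroʳ (- signℤ ∣ A ∣)) Ss
  inside-half inside = begin
    sumℤ (map (λ A → - signℤ ∣ A ∣ * iverson (does (A ⊆? R))) Ss)
      ≡⟨ sumℤ-map-cong _ (λ A → sym (neg-distribˡ-* (signℤ ∣ A ∣) _)) Ss ⟩
    sumℤ (map (λ A → - g R A) Ss)
      ≡⟨ sumℤ-map-neg (g R) Ss ⟩
    - sumℤ (map (g R) Ss)
      ≡⟨ cong -_ (alternating-sum-⊆ R) ⟩
    - iverson (does (R ⊆? ⊥)) ∎

  cancel : ∀ r → (if r then - iverson (does (R ⊆? ⊥)) else + 0) + iverson (does (R ⊆? ⊥))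
                   ≡ iverson (does (r ∷ R ⊆? ⊥))
  cancel outside = +-identityˡ _
  cancel inside = +-inverseˡ (iverson (does (R ⊆? ⊥)))

sumℤ-∣A∣≡ᵇ0 : ∀ m → sumℤ (map (λ A → iverson (∣ A ∣ ≡ᵇ 0)) (allSubsets m)) ≡ + 1
sumℤ-∣A∣≡ᵇ0 zero = refl
sumℤ-∣A∣≡ᵇ0 (suc m) =
  trans (sumℤ-allSubsets-suc {m} (λ A → iverson (∣ A ∣ ≡ᵇ 0)))
        (cong₂ _+_ (sumℤ-map-zero (λ A → iverson (∣ inside Vec.∷ A ∣ ≡ᵇ 0)) (λ _ → refl) Ss)
                   (sumℤ-∣A∣≡ᵇ0 m))
  where Ss = allSubsets m

sumℤ-nonempty-⊆ : ∀ {m} (P : Subset m → Bool) (R : Subset m) →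
  (∀ {A} → A ⊆ R → P A ≡ not (∣ A ∣ ≡ᵇ 0)) →
  sumℤ (map (λ A → signℤ (suc ∣ A ∣) * iverson (does (A ⊆? R))) (filterᵇ P (allSubsets m)))
    ≡ iverson (not (does (R ⊆? ⊥)))
sumℤ-nonempty-⊆ {m} P R P-on-⊆R = begin
  sumℤ (map f (filterᵇ P Ss))
    ≡⟨ sumℤ-filterᵇ f P Ss ⟩
  sumℤ (map (λ A → if P A then f A else + 0) Ss)
    ≡⟨ sumℤ-map-cong _ termwise Ss ⟩
  sumℤ (map (λ A → - g A + e A) Ss)
    ≡⟨ sumℤ-map-+ (λ A → - g A) e Ss ⟩
  sumℤ (map (λ A → - g A) Ss) + sumℤ (map e Ss)
    ≡⟨ cong₂ _+_ (sumℤ-map-neg g Ss) (sumℤ-∣A∣≡ᵇ0 m) ⟩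
  - sumℤ (map g Ss) + + 1
    ≡⟨ cong (λ s → - s + + 1) (alternating-sum-⊆ R) ⟩
  - iverson (does (R ⊆? ⊥)) + + 1
    ≡⟨ iverson-not _ ⟩
  iverson (not (does (R ⊆? ⊥))) ∎
  where
  Ss = allSubsets m
  f g e : Subset m → ℤ
  f A = signℤ (suc ∣ A ∣) * iverson (does (A ⊆? R))
  g A = signℤ ∣ A ∣ * iverson (does (A ⊆? R))
  e A = iverson (∣ A ∣ ≡ᵇ 0)

  term-⊆ : ∀ k → (if not (k ≡ᵇ 0) then signℤ (suc k) * + 1 else + 0)
                   ≡ - (signℤ k * + 1) + iverson (k ≡ᵇ 0)
  term-⊆ zero = refl
  term-⊆ (suc k) = sym (trans (+-identityʳ _) (neg-distribˡ-* (signℤ (suc k)) (+ 1)))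

  if-zero : ∀ b {x : ℤ} → x ≡ + 0 → (if b then x else + 0) ≡ + 0
  if-zero true x≡0 = x≡0
  if-zero false _ = refl

  termwise : ∀ A → (if P A then f A else + 0) ≡ - g A + e A
  termwise A with A ⊆? R
  ... | yes A⊆R =
    trans (cong (λ b → if b then signℤ (suc ∣ A ∣) * + 1 else + 0) (P-on-⊆R A⊆R)) (term-⊆ ∣ A ∣)
  ... | no A⊈R with ∣ A ∣ ≡ᵇ 0 in ∣A∣≡ᵇ0
  ...   | true = contradiction (λ {x} x∈A → ⊥-elim (∣p∣≡0⇒¬Nonempty ∣A∣≡0 (x , x∈A))) A⊈R
    where ∣A∣≡0 = ≡ᵇ⇒≡ ∣ A ∣ 0 (from T-≡ ∣A∣≡ᵇ0)
  ...   | false = trans (if-zero (P A) (*-zeroʳ (signℤ (suc ∣ A ∣))))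
                        (sym (cong (λ z → - z + + 0) (*-zeroʳ (signℤ ∣ A ∣))))

module _ {N : Set} (_≟_ : (x y : N) → Dec (x ≡ y)) (D : N → N → Bool) (L : List N) where

  cD-sink : ∀ {a} → a ∈ₗ L → (∀ {b} → b ∈ₗ L → b ≢ a → T (D b a)) → cD _≟_ D L ≡ + 1
  cD-sink {a} a∈L parents = iverson-T (any⁺ _ (lose a∈L (all⁻ _ (All.tabulate parent-or-self))))
    where
    parent-or-self : ∀ {b} → b ∈ₗ L → T (does (b ≟ a) ∨ D b a)
    parent-or-self {b} b∈L with b ≟ a
    ... | yes _ = _
    ... | no b≢a = parents b∈L b≢a

  cD-no-sink : (∀ {a} → a ∈ₗ L → ∃ λ b → b ∈ₗ L × b ≢ a × ¬ T (D b a)) → cD _≟_ D L ≡ + 0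
  cD-no-sink non-parent = iverson-¬T λ has-sink →
    let a , a∈L , all-parents = find (any⁻ _ L has-sink)
        b , b∈L , b≢a , ¬Dba = non-parent a∈L
    in not-parent-or-self b≢a ¬Dba (All.lookup (all⁺ _ L all-parents) b∈L)
    where
    not-parent-or-self : ∀ {a b} → b ≢ a → ¬ T (D b a) → ¬ T (does (b ≟ a) ∨ D b a)
    not-parent-or-self {a} {b} b≢a ¬Dba with b ≟ a
    ... | yes b≡a = contradiction b≡a b≢a
    ... | no _ = ¬Dba

module _ {m : ℕ} {I : Fin m → Bool} (G : Fin m → Fin m → Bool) {B : Subset m} where

  cD-elems-sink : ∀ {x} → x ∈ B → (∀ {y} → y ∈ B → y ≢ x → T (G y x)) →
                  cD _≟N_ (arrI G I) (map inj₁ (elems B)) ≡ + 1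
  cD-elems-sink {x} x∈B parents = cD-sink _≟N_ (arrI G I) _ (∈-map⁺ inj₁ (∈-elems⁺ x∈B)) parent
    where
    parent : ∀ {b} → b ∈ₗ map inj₁ (elems B) → b ≢ inj₁ x → T (arrI G I b (inj₁ x))
    parent b∈ b≢x with ∈-map⁻ inj₁ b∈
    ... | y , y∈ , refl = parents (∈-elems⁻ y∈) (b≢x ∘ cong inj₁)

  cD-elems-no-sink : (∀ {x} → x ∈ B → ∃ λ y → y ∈ B × y ≢ x × ¬ T (G y x)) →
                     cD _≟N_ (arrI G I) (map inj₁ (elems B)) ≡ + 0
  cD-elems-no-sink non-parent = cD-no-sink _≟N_ (arrI G I) _ non-parent′
    where
    non-parent′ : ∀ {a} → a ∈ₗ map inj₁ (elems B) →
                  ∃ λ b → b ∈ₗ map inj₁ (elems B) × b ≢ a × ¬ T (arrI G I b a)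
    non-parent′ a∈ with ∈-map⁻ inj₁ a∈
    ... | x , x∈ , refl =
      let y , y∈B , y≢x , ¬Gyx = non-parent (∈-elems⁻ x∈)
      in inj₁ y , ∈-map⁺ inj₁ (∈-elems⁺ y∈B) , y≢x ∘ inj₁-injective , ¬Gyx

module Star {m : ℕ} {S : Fin m → Fin m → Bool} (star : IsStar m S) where

  center : Fin m
  center = proj₁ (proj₂ star)

  edge⇒spoke : ∀ {x y} → T (S x y) → (x ≡ center × y ≢ center) ⊎ (y ≡ center × x ≢ center)
  edge⇒spoke {x} {y} = proj₁ (proj₂ (proj₂ star) x y)

  spoke⇒edge : ∀ {x y} → (x ≡ center × y ≢ center) ⊎ (y ≡ center × x ≢ center) → T (S x y)
  spoke⇒edge {x} {y} = proj₂ (proj₂ (proj₂ star) x y)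

  irreflexive : ∀ {x} → ¬ T (S x x)
  irreflexive x—x = [ (λ (x≡c , x≢c) → x≢c x≡c) , (λ (x≡c , x≢c) → x≢c x≡c) ]′ (edge⇒spoke x—x)

  leaves-nonadjacent : ∀ {x y} → x ≢ center → y ≢ center → ¬ T (S x y)
  leaves-nonadjacent x≢c y≢c x—y = [ x≢c ∘ proj₁ , y≢c ∘ proj₁ ]′ (edge⇒spoke x—y)

  center-not-leaf : ¬ IsLeaf (λ x y → T (S x y)) center
  center-not-leaf (w , c—w , unique) =
    let x , x≢w , x≢c = third-element (proj₁ star) w≢c
    in x≢w (unique x (spoke⇒edge (inj₁ (refl , x≢c))))
    where
    w≢c : w ≢ center
    w≢c refl = irreflexive c—w

  intervened-leaf : ∀ (I : Fin m → Bool) {v} → v ≢ center → ¬ T (I v) → IsLeaf (skelI S I) (inj₁ v)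
  intervened-leaf I {v} v≢c v∉I = inj₁ center , spoke⇒edge (inj₂ (refl , v≢c)) , unique
    where
    unique : ∀ y → skelI S I (inj₁ v) y → y ≡ inj₁ center
    unique (inj₁ y) v—y with edge⇒spoke v—y
    ... | inj₁ (v≡c , _) = contradiction v≡c v≢c
    ... | inj₂ (y≡c , _) = cong inj₁ y≡c
    unique (inj₂ (w , w∈I)) refl = contradiction w∈I v∉I

IndicatesVStructure : ∀ {m} (G : Fin m → Fin m → Bool) (I : Fin m → Bool) (u v : Fin m) → Set
IndicatesVStructure G I u v =
  (InVStructure (arrI G I) (inj₁ u) (inj₁ v) → indicator I u v (cD _≟N_ (arrI G I)) ≡ + 1) ×
  (¬ InVStructure (arrI G I) (inj₁ u) (inj₁ v) → indicator I u v (cD _≟N_ (arrI G I)) ≡ + 0)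

module IntervenedHead {m : ℕ} (G : Fin m → Fin m → Bool) (I : Fin m → Bool) {u v : Fin m}
  (u≢v : u ≢ v) (v∈I : T (I v)) where

  v′ : Node m I
  v′ = inj₂ (v , v∈I)

  v′→v : T (arrI G I v′ (inj₁ v))
  v′→v = T-does⁺ (v ≟F v) refl

  v′↛u : ¬ T (arrI G I v′ (inj₁ u))
  v′↛u = u≢v ∘ sym ∘ T-does⁻ (v ≟F u)

  cD-uvv′ : cD _≟N_ (arrI G I) (inj₁ u ∷ inj₁ v ∷ v′ ∷ []) ≡ iverson (G u v)
  cD-uvv′ = ≡iverson (G u v) (cD-sink _≟N_ (arrI G I) _ (there (here refl)) ∘ parent)
                             (cD-no-sink _≟N_ (arrI G I) _ ∘ non-parent)
    where
    parent : T (G u v) → ∀ {b} → b ∈ₗ inj₁ u ∷ inj₁ v ∷ v′ ∷ [] → b ≢ inj₁ v →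
             T (arrI G I b (inj₁ v))
    parent u→v (here refl) _ = u→v
    parent _ (there (here refl)) v≢v = contradiction refl v≢v
    parent _ (there (there (here refl))) _ = v′→v

    non-parent : ¬ T (G u v) → ∀ {a} → a ∈ₗ inj₁ u ∷ inj₁ v ∷ v′ ∷ [] →
                 ∃ λ b → b ∈ₗ inj₁ u ∷ inj₁ v ∷ v′ ∷ [] × b ≢ a × ¬ T (arrI G I b a)
    non-parent _ (here refl) = v′ , there (there (here refl)) , (λ ()) , v′↛u
    non-parent u↛v (there (here refl)) = inj₁ u , here refl , u≢v ∘ inj₁-injective , u↛v
    non-parent _ (there (there (here refl))) = inj₁ u , here refl , (λ ()) , λ ()

  vstructure⇔ : InVStructure (arrI G I) (inj₁ u) (inj₁ v) ⇔ T (G u v)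
  vstructure⇔ = mk⇔ proj₁ λ u→v → u→v , v′ , v′→v , (λ ()) , v′↛u

  indicates-vstructure : IndicatesVStructure G I u v
  indicates-vstructure = iverson-cases _ (trans (caseT-true v∈I _ _) cD-uvv′) vstructure⇔

module CenterHead {m : ℕ} (G : Fin m → Fin m → Bool) (I : Fin m → Bool) {u v : Fin m}
  (u≢v : u ≢ v) (v∉I : ¬ T (I v)) (¬v→v : ¬ T (G v v))
  (spokes : ∀ {x y} → x ≢ v → y ≢ v → ¬ T (G x y)) where

  otherParents : Subset m
  otherParents = tabulate λ x → does (T? (G x v) ×-dec ¬? (x ≟F u))

  ∈otherParents⁺ : ∀ {x} → T (G x v) → x ≢ u → x ∈ otherParents
  ∈otherParents⁺ {x} x→v x≢u =
    T-lookup⇒∈ (subst T (sym (lookup∘tabulate _ x))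
                        (T-does⁺ (T? (G x v) ×-dec ¬? (x ≟F u)) (x→v , x≢u)))

  ∈otherParents⁻ : ∀ {x} → x ∈ otherParents → T (G x v) × x ≢ u
  ∈otherParents⁻ {x} x∈ =
    T-does⁻ (T? (G x v) ×-dec ¬? (x ≟F u)) (subst T (lookup∘tabulate _ x) (∈⇒T-lookup x∈))

  u∉otherParents : u ∉ otherParents
  u∉otherParents u∈ = proj₂ (∈otherParents⁻ u∈) refl

  v∉otherParents : v ∉ otherParents
  v∉otherParents v∈ = ¬v→v (proj₁ (∈otherParents⁻ v∈))

  module _ {A : Subset m} where

    A∪uv : Subset m
    A∪uv = A ∪ (⁅ u ⁆ ∪ ⁅ v ⁆)

    ∈A∪uv⁻ : ∀ {x} → x ∈ A∪uv → x ∈ A ⊎ x ≡ u ⊎ x ≡ v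
    ∈A∪uv⁻ x∈ = Sum.map₂ (Sum.map (x∈⁅y⁆⇒x≡y u) (x∈⁅y⁆⇒x≡y v) ∘ x∈p∪q⁻ _ _) (x∈p∪q⁻ A _ x∈)

    A⊆A∪uv : A ⊆ A∪uv
    A⊆A∪uv = x∈p∪q⁺ ∘ inj₁

    u∈A∪uv : u ∈ A∪uv
    u∈A∪uv = x∈p∪q⁺ (inj₂ (x∈p∪q⁺ (inj₁ (x∈⁅x⁆ u))))

    v∈A∪uv : v ∈ A∪uv
    v∈A∪uv = x∈p∪q⁺ (inj₂ (x∈p∪q⁺ (inj₂ (x∈⁅x⁆ v))))

    module _ (u∉A : u ∉ A) (v∉A : v ∉ A) (A-nonempty : Nonempty A) where

      parent : T (G u v) → A ⊆ otherParents → ∀ {y} → y ∈ A∪uv → y ≢ v → T (G y v)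
      parent u→v A⊆R y∈ y≢v with ∈A∪uv⁻ y∈
      ... | inj₁ y∈A = proj₁ (∈otherParents⁻ (A⊆R y∈A))
      ... | inj₂ (inj₁ refl) = u→v
      ... | inj₂ (inj₂ refl) = contradiction refl y≢v

      v-not-sink : ¬ T (G u v ∧ does (A ⊆? otherParents)) →
                   ∃ λ y → y ∈ A∪uv × y ≢ v × ¬ T (G y v)
      v-not-sink ¬sink with T? (G u v)
      ... | no u↛v = u , u∈A∪uv , u≢v , u↛v
      ... | yes u→v =
        let j , j∈A , j∉R = ⊈-witness λ A⊆R →
              ¬sink (from T-∧ (u→v , T-does⁺ (A ⊆? otherParents) A⊆R))
        in j , A⊆A∪uv j∈A , ∈-∉-≢ j∈A v∉A , λ j→v → j∉R (∈otherParents⁺ j→v (∈-∉-≢ j∈A u∉A))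

      non-parent : (∃ λ y → y ∈ A∪uv × y ≢ v × ¬ T (G y v)) →
                   ∀ {x} → x ∈ A∪uv → ∃ λ y → y ∈ A∪uv × y ≢ x × ¬ T (G y x)
      non-parent v-non-parent x∈ with ∈A∪uv⁻ x∈
      ... | inj₁ x∈A =
        u , u∈A∪uv , ∈-∉-≢ x∈A u∉A ∘ sym , spokes u≢v (∈-∉-≢ x∈A v∉A)
      ... | inj₂ (inj₁ refl) =
        let i , i∈A = A-nonempty
        in i , A⊆A∪uv i∈A , ∈-∉-≢ i∈A u∉A , spokes (∈-∉-≢ i∈A v∉A) u≢v
      ... | inj₂ (inj₂ refl) = v-non-parent

      cD-A∪uv : cD _≟N_ (arrI G I) (map inj₁ (elems A∪uv))
                  ≡ iverson (G u v ∧ does (A ⊆? otherParents))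
      cD-A∪uv = ≡iverson _
        (λ sink → let u→v , A⊆R = to T-∧ sink
                  in cD-elems-sink G v∈A∪uv (parent u→v (T-does⁻ (A ⊆? otherParents) A⊆R)))
        (cD-elems-no-sink G ∘ non-parent ∘ v-not-sink)

  -- the index set of the sum defining `indicator` when v ∉ I
  selected : Subset m → Bool
  selected A = not (lookup A u) ∧ not (lookup A v) ∧ not (∣ A ∣ ≡ᵇ 0)

  selected⇒ : ∀ {A} → T (selected A) → u ∉ A × v ∉ A × Nonempty A
  selected⇒ {A} A-selected =
    let u∉A , rest = to T-∧ A-selected
        v∉A , ∣A∣≢0 = to T-∧ rest
    in T-not-lookup⇒∉ u∉A , T-not-lookup⇒∉ v∉A ,
       ∣p∣≢0⇒Nonempty (λ ∣A∣≡0 → subst (λ k → T (not (k ≡ᵇ 0))) ∣A∣≡0 ∣A∣≢0)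

  selected-on-⊆ : ∀ {A} → A ⊆ otherParents → selected A ≡ not (∣ A ∣ ≡ᵇ 0)
  selected-on-⊆ A⊆R
    rewrite ∉⇒lookup≡outside (u∉otherParents ∘ A⊆R)
          | ∉⇒lookup≡outside (v∉otherParents ∘ A⊆R) = refl

  indicator≡ : indicator I u v (cD _≟N_ (arrI G I))
                 ≡ iverson (G u v ∧ not (does (otherParents ⊆? ⊥)))
  indicator≡ = begin
    indicator I u v (cD _≟N_ (arrI G I))
      ≡⟨ caseT-false v∉I _ _ ⟩
    sumℤ (map (λ A → signℤ (suc ∣ A ∣) * cD _≟N_ (arrI G I) (map inj₁ (elems (A∪uv {A}))))
              (filterᵇ selected Ss))
      ≡⟨ sumℤ-filterᵇ-cong _ selected
           (λ {A} A-selected → let u∉A , v∉A , A-nonempty = selected⇒ {A} A-selected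
                               in cong (signℤ (suc ∣ A ∣) *_) (cD-A∪uv {A} u∉A v∉A A-nonempty)) Ss ⟩
    sumℤ (map (λ A → signℤ (suc ∣ A ∣) * iverson (G u v ∧ does (A ⊆? otherParents)))
              (filterᵇ selected Ss))
      ≡⟨ by-arrow (G u v) ⟩
    iverson (G u v ∧ not (does (otherParents ⊆? ⊥))) ∎
    where
    Ss = allSubsets m
    by-arrow : ∀ b →
      sumℤ (map (λ A → signℤ (suc ∣ A ∣) * iverson (b ∧ does (A ⊆? otherParents)))
                (filterᵇ selected Ss))
        ≡ iverson (b ∧ not (does (otherParents ⊆? ⊥)))
    by-arrow false = sumℤ-map-zero _ (λ A → *-zeroʳ (signℤ (suc ∣ A ∣))) (filterᵇ selected Ss)
    by-arrow true = sumℤ-nonempty-⊆ selected otherParents selected-on-⊆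

  vstructure⇔ : InVStructure (arrI G I) (inj₁ u) (inj₁ v)
                  ⇔ T (G u v ∧ not (does (otherParents ⊆? ⊥)))
  vstructure⇔ = mk⇔ vstructure⇒ vstructure⇐
    where
    vstructure⇒ : InVStructure (arrI G I) (inj₁ u) (inj₁ v) →
                  T (G u v ∧ not (does (otherParents ⊆? ⊥)))
    vstructure⇒ (u→v , inj₁ d , d→v , d≢u , _) =
      from T-∧ (u→v , T-does⁺ (¬? (otherParents ⊆? ⊥))
                        λ R⊆⊥ → ∉⊥ (R⊆⊥ (∈otherParents⁺ d→v (d≢u ∘ cong inj₁))))
    vstructure⇒ (_ , inj₂ (w , w∈I) , w′→v , _) =
      contradiction (subst (T ∘ I) (T-does⁻ (w ≟F v) w′→v) w∈I) v∉I

    vstructure⇐ : T (G u v ∧ not (does (otherParents ⊆? ⊥))) →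
                  InVStructure (arrI G I) (inj₁ u) (inj₁ v)
    vstructure⇐ t =
      let u→v , R≢∅ = to T-∧ t
          d , d∈R , _ = ⊈-witness (T-does⁻ (¬? (otherParents ⊆? ⊥)) R≢∅)
          d→v , d≢u = ∈otherParents⁻ d∈R
          d≢v = ∈-∉-≢ d∈R v∉otherParents
      in u→v , inj₁ d , d→v , d≢u ∘ inj₁-injective ,
         λ u—d → [ spokes u≢v d≢v , spokes d≢v u≢v ]′ (to T-∨ u—d)

  indicates-vstructure : IndicatesVStructure G I u v
  indicates-vstructure = iverson-cases _ indicator≡ vstructure⇔

proposition5p7 : (m : ℕ) (S : Fin m → Fin m → Bool) → IsStar m S →
    (I : Fin m → Bool) → (∀ w → T (I w) → IsLeaf (λ x y → T (S x y)) w) →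
    (v : Fin m) → ¬ IsLeaf (skelI S I) (inj₁ v) →
    (G : Fin m → Fin m → Bool) → IsDAG G → HasSkeleton G S →
    (u : Fin m) → T (S u v) →
    (InVStructure (arrI G I) (inj₁ u) (inj₁ v) →
       indicator I u v (cD _≟N_ (arrI G I)) ≡ + 1) ×
    (¬ InVStructure (arrI G I) (inj₁ u) (inj₁ v) →
       indicator I u v (cD _≟N_ (arrI G I)) ≡ + 0)
proposition5p7 m S star I I-leaves v v-nonleaf G acyclic skeleton u u—v = by-position (v ≟F center)
  where
  open Star star

  u≢v : u ≢ v
  u≢v refl = irreflexive u—v

  arrow⇒edge : ∀ {x y} → T (G x y) → T (S x y)
  arrow⇒edge {x} {y} = proj₁ (proj₂ (skeleton x y))

  by-position : Dec (v ≡ center) → IndicatesVStructure G I u v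
  by-position (yes refl) =
    CenterHead.indicates-vstructure G I u≢v (center-not-leaf ∘ I-leaves v) (acyclic v ∘ edge)
      (λ x≢c y≢c → leaves-nonadjacent x≢c y≢c ∘ arrow⇒edge)
  by-position (no v≢c) =
    IntervenedHead.indicates-vstructure G I u≢v
      (decidable-stable (T? (I v)) (v-nonleaf ∘ intervened-leaf I v≢c))
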